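{- Let $n>1$. Then $\log_2(|HVC_n|)\ge\left\lfloor\frac n2\right\rfloor\left(\left\lceil\frac n2\right\rceil+1\right)\ge\frac{n^2}{4}-1$.
   Context: Let $K_{n,n}$ have left side $A$ and right side $B$, $|A|=|B|=n$; graphs are spanning subgraphs identified with edge sets. $HV_n$ (Hall violators) is the set of graphs $K_{X,Y}$ with edge set $X\times Y$ for $X\subseteq A$, $Y\subseteq B$, $|X|+|Y|=n+1$. $HVC_n$ is the set of graphs $G\subseteq K_{n,n}$ such that there exists $S\subseteq HV_n$ with $\bigcup_{H\in S}E(H)=E(G)$. -}

module Defs where

open import Data.Nat using (ℕ; suc; _+_; _*_; ⌊_/2⌋; ⌈_/2⌉)
open import Data.Bool using (Bool; false; _∧_; _∨_)
open import Data.Fin using (Fin)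
open import Data.Fin.Subset using (Subset; ∣_∣)
open import Data.Vec using (Vec; lookup; tabulate; replicate; zipWith)
open import Data.List using (List; foldr)
open import Data.Product using (Σ; _,_)
open import Relation.Binary.PropositionalEquality using (_≡_)

-- A spanning subgraph of K_{n,n} with sides A = B = Fin n, identified with
-- its edge set: (G [i][j] ≡ true) iff the edge (i ∈ A, j ∈ B) is present.
Graph : ℕ → Set
Graph n = Vec (Vec Bool n) n

emptyGraph : ∀ {n} → Graph n
emptyGraph {n} = replicate n (replicate n false)

_∪G_ : ∀ {n} → Graph n → Graph n → Graph n
G ∪G H = zipWith (zipWith _∨_) G H

K : ∀ {n} → Subset n → Subset n → Graph n
K X Y = tabulate λ i → tabulate λ j → lookup X i ∧ lookup Y j

record HallViolator (n : ℕ) : Set where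
  constructor hv
  field
    X : Subset n
    Y : Subset n
    size : ∣ X ∣ + ∣ Y ∣ ≡ suc n

graphOf : ∀ {n} → HallViolator n → Graph n
graphOf H = K (HallViolator.X H) (HallViolator.Y H)

⋃ : ∀ {n} → List (HallViolator n) → Graph n
⋃ = foldr (λ H acc → graphOf H ∪G acc) emptyGraph

-- G ∈ HVC_n: G is the union of some family of Hall violators.
-- (HV_n is finite, so every S ⊆ HV_n is listed by some list.)
IsHVC : ∀ {n} → Graph n → Set
IsHVC {n} G = Σ (List (HallViolator n)) λ S → ⋃ S ≡ G

bound : ℕ → ℕ
bound n = ⌊ n /2⌋ * (⌈ n /2⌉ + 1)

-- Write ⌊n/2⌋ = a + 1, ⌈n/2⌉ = b and split A = A₁ ⊔ A₂, B = B₁ ⊔ B₂ with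
-- |A₁| = a + 1, |A₂| = b, |B₁| = a, |B₂| = b + 1. For p ∈ A₁ and q ∈ B₂ the sets
-- X = {p} ∪ A₂ and Y = B₁ ∪ {q} have |X| + |Y| = n + 1, and the edge pq lies in
-- no other of these (a + 1)(b + 1) Hall violators. So distinct subfamilies have
-- distinct unions, giving 2 ^ ((a + 1)(b + 1)) graphs in HVC_n. The numeric bound
-- passes from n to n + 2 because bound (n + 2) = bound n + n + 2.

module Submission where

open import Defs
open import Data.Nat using (ℕ; zero; suc; _*_; _+_; _^_; _≤_; _<_; z≤n; s≤s; ⌊_/2⌋; ⌈_/2⌉)
open import Data.Nat.Properties using (+-suc; +-comm; +-mono-≤; m≤m+n; ⌊n/2⌋+⌈n/2⌉≡n; module ≤-Reasoning)
open import Data.Nat.Tactic.RingSolver using (solve-∀)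
open import Data.Bool using (Bool; true; false; T; _∧_; _∨_)
open import Data.Bool.ListAction using (any)
open import Data.Bool.Properties using (T-≡; T-∧; ⇔→≡)
open import Data.Fin using (Fin; _↑ˡ_; _↑ʳ_; remQuot; combine; finToFun; funToFin) renaming (cast to castF)
open import Data.Fin.Properties using (2↔Bool; combine-remQuot; funToFin-finToFin)
open import Data.Fin.Subset using (Subset; ∣_∣; ⁅_⁆; ⊤)
open import Data.Fin.Subset.Properties using (∣⊤∣≡n; ∣⁅x⁆∣≡1; x∈⁅x⁆; x∈⁅y⁆⇒x≡y)
open import Data.Vec using ([]; _∷_; lookup; replicate; zipWith; _++_; cast)
open import Data.Vec.Properties using (lookup∘tabulate; lookup-zipWith; lookup-replicate; lookup-++ˡ; lookup-++ʳ; lookup-cast; cast-is-id; []=⇒lookup; lookup⇒[]=)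
open import Data.List using (List; []; _∷_; map; filter; allFin)
open import Data.List.Membership.Propositional using (find; lose)
open import Data.List.Membership.Propositional.Properties using (∈-map⁺; ∈-map⁻; ∈-filter⁺; ∈-filter⁻; ∈-allFin)
open import Data.List.Relation.Unary.Any.Properties using (any⁺; any⁻)
open import Data.Product using (Σ; _×_; _,_; proj₁; proj₂; uncurry)
open import Function using (_∘_; Inverse; Injection; Equivalence; mk⇔)
open import Function.Properties.Inverse using (↔⇒↣)
open import Function.Definitions using (Injective)
open import Relation.Binary.PropositionalEquality using (_≡_; _≗_; refl; sym; trans; cong; cong₂; subst; module ≡-Reasoning)
open import Relation.Nullary.Decidable using (T?)

edge : ∀ {n} → Graph n → Fin n → Fin n → Bool
edge G i j = lookup (lookup G i) j

edge-emptyGraph : ∀ {n} (i j : Fin n) → edge emptyGraph i j ≡ false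
edge-emptyGraph {n} i j = begin
  lookup (lookup (emptyGraph {n}) i) j ≡⟨ cong (λ row → lookup row j) (lookup-replicate i (replicate n false)) ⟩
  lookup (replicate n false) j         ≡⟨ lookup-replicate j false ⟩
  false                                ∎
  where open ≡-Reasoning

edge-∪G : ∀ {n} (G H : Graph n) i j → edge (G ∪G H) i j ≡ edge G i j ∨ edge H i j
edge-∪G G H i j = begin
  lookup (lookup (G ∪G H) i) j                       ≡⟨ cong (λ row → lookup row j) (lookup-zipWith (zipWith _∨_) i G H) ⟩
  lookup (zipWith _∨_ (lookup G i) (lookup H i)) j   ≡⟨ lookup-zipWith _∨_ j (lookup G i) (lookup H i) ⟩
  edge G i j ∨ edge H i j                            ∎
  where open ≡-Reasoning

edge-K : ∀ {n} (X Y : Subset n) i j → edge (K X Y) i j ≡ lookup X i ∧ lookup Y j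
edge-K X Y i j = trans (cong (λ row → lookup row j) (lookup∘tabulate _ i)) (lookup∘tabulate _ j)

edge-⋃ : ∀ {n} (Hs : List (HallViolator n)) i j → edge (⋃ Hs) i j ≡ any (λ H → edge (graphOf H) i j) Hs
edge-⋃ []       i j = edge-emptyGraph i j
edge-⋃ (H ∷ Hs) i j = trans (edge-∪G (graphOf H) (⋃ Hs) i j) (cong (edge (graphOf H) i j ∨_) (edge-⋃ Hs i j))

HVCFamily : ℕ → ℕ → Set
HVCFamily n m = Σ (Fin (2 ^ m) → Graph n) (λ f → Injective _≡_ _≡_ f × ((i : Fin (2 ^ m)) → IsHVC (f i)))

funToFin-cong : ∀ {m n} {f g : Fin m → Fin n} → f ≗ g → funToFin f ≡ funToFin g
funToFin-cong {zero}  f≗g = refl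
funToFin-cong {suc m} f≗g = cong₂ combine (f≗g Fin.zero) (funToFin-cong (f≗g ∘ Fin.suc))

finToFun-injective : ∀ {m n} {x y : Fin (n ^ m)} → finToFun {n} {m} x ≗ finToFun y → x ≡ y
finToFun-injective {m} {n} {x} {y} eq = begin
  x                             ≡⟨ sym (funToFin-finToFin {m} {n} x) ⟩
  funToFin {m} {n} (finToFun x) ≡⟨ funToFin-cong eq ⟩
  funToFin {m} {n} (finToFun y) ≡⟨ funToFin-finToFin {m} {n} y ⟩
  y                             ∎
  where open ≡-Reasoning

bits : ∀ {m} → Fin (2 ^ m) → Fin m → Bool
bits {m} x = Inverse.to 2↔Bool ∘ finToFun {2} {m} x

bits-injective : ∀ {m} {x y : Fin (2 ^ m)} → bits x ≗ bits y → x ≡ y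
bits-injective {m} eq = finToFun-injective {m} (Injection.injective (↔⇒↣ 2↔Bool) ∘ eq)

module PrivateEdges {n m} (v : Fin m → HallViolator n) (row col : Fin m → Fin n)
  (owns : ∀ k → T (edge (graphOf (v k)) (row k) (col k)))
  (owned-only-by : ∀ {k k′} → T (edge (graphOf (v k′)) (row k) (col k)) → k′ ≡ k)
  where

  selected : (Fin m → Bool) → List (HallViolator n)
  selected s = map v (filter (T? ∘ s) (allFin m))

  edge-⋃-selected : ∀ s k → edge (⋃ (selected s)) (row k) (col k) ≡ s k
  edge-⋃-selected s k =
    ⇔→≡ (mk⇔ (Equivalence.to T-≡ ∘ to ∘ Equivalence.from T-≡) (Equivalence.to T-≡ ∘ from ∘ Equivalence.from T-≡))
    where
    hasPrivateEdge : HallViolator n → Bool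
    hasPrivateEdge H = edge (graphOf H) (row k) (col k)

    to : T (edge (⋃ (selected s)) (row k) (col k)) → T (s k)
    to e with find (any⁻ hasPrivateEdge (selected s) (subst T (edge-⋃ (selected s) (row k) (col k)) e))
    ... | H , H∈ , eH with ∈-map⁻ v H∈
    ...   | k′ , k′∈ , refl = subst (T ∘ s) (owned-only-by eH) (proj₂ (∈-filter⁻ (T? ∘ s) {xs = allFin m} k′∈))

    from : T (s k) → T (edge (⋃ (selected s)) (row k) (col k))
    from t = subst T (sym (edge-⋃ (selected s) (row k) (col k)))
      (any⁺ hasPrivateEdge (lose (∈-map⁺ v (∈-filter⁺ (T? ∘ s) (∈-allFin k) t)) (owns k)))

  ⋃-selected-injective : ∀ {s t} → ⋃ (selected s) ≡ ⋃ (selected t) → s ≗ t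
  ⋃-selected-injective {s} {t} eq k = begin
    s k                                   ≡⟨ sym (edge-⋃-selected s k) ⟩
    edge (⋃ (selected s)) (row k) (col k) ≡⟨ cong (λ G → edge G (row k) (col k)) eq ⟩
    edge (⋃ (selected t)) (row k) (col k) ≡⟨ edge-⋃-selected t k ⟩
    t k                                   ∎
    where open ≡-Reasoning

  hvcFamily : HVCFamily n m
  hvcFamily = ⋃ ∘ selected ∘ bits {m} , bits-injective {m} ∘ ⋃-selected-injective , λ x → selected (bits x) , refl

∣++∣ : ∀ {m k} (u : Subset m) (w : Subset k) → ∣ u ++ w ∣ ≡ ∣ u ∣ + ∣ w ∣
∣++∣ []          w = refl
∣++∣ (true ∷ u)  w = cong suc (∣++∣ u w)
∣++∣ (false ∷ u) w = ∣++∣ u w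

∣cast∣ : ∀ {m k} (eq : m ≡ k) (u : Subset m) → ∣ cast eq u ∣ ≡ ∣ u ∣
∣cast∣ refl u = cong ∣_∣ (cast-is-id refl u)

T-lookup-⁅x⁆ : ∀ {m} (x : Fin m) → T (lookup ⁅ x ⁆ x)
T-lookup-⁅x⁆ x = Equivalence.from T-≡ ([]=⇒lookup (x∈⁅x⁆ x))

T-lookup-⁅y⁆⇒x≡y : ∀ {m} {x y : Fin m} → T (lookup ⁅ y ⁆ x) → x ≡ y
T-lookup-⁅y⁆⇒x≡y {x = x} {y} t = x∈⁅y⁆⇒x≡y y (lookup⇒[]= x ⁅ y ⁆ (Equivalence.to T-≡ t))

module Staircase (a b : ℕ) where

  n : ℕ
  n = suc a + b

  a+[b+1]≡n : a + (b + 1) ≡ n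
  a+[b+1]≡n = trans (cong (a +_) (+-comm b 1)) (+-suc a b)

  X : Fin (suc a) → Subset n
  X p = ⁅ p ⁆ ++ ⊤

  Y : Fin (b + 1) → Subset n
  Y q = cast a+[b+1]≡n (⊤ {a} ++ ⁅ q ⁆)

  ∣X∣+∣Y∣≡1+n : ∀ p q → ∣ X p ∣ + ∣ Y q ∣ ≡ suc n
  ∣X∣+∣Y∣≡1+n p q = begin
    ∣ ⁅ p ⁆ ++ ⊤ ∣ + ∣ Y q ∣                            ≡⟨ cong₂ _+_ (∣++∣ ⁅ p ⁆ (⊤ {b})) (∣cast∣ a+[b+1]≡n (⊤ {a} ++ ⁅ q ⁆)) ⟩
    (∣ ⁅ p ⁆ ∣ + ∣ ⊤ {b} ∣) + ∣ ⊤ {a} ++ ⁅ q ⁆ ∣         ≡⟨ cong ((∣ ⁅ p ⁆ ∣ + ∣ ⊤ {b} ∣) +_) (∣++∣ (⊤ {a}) ⁅ q ⁆) ⟩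
    (∣ ⁅ p ⁆ ∣ + ∣ ⊤ {b} ∣) + (∣ ⊤ {a} ∣ + ∣ ⁅ q ⁆ ∣)     ≡⟨ cong₂ _+_ (cong₂ _+_ (∣⁅x⁆∣≡1 p) (∣⊤∣≡n b)) (cong₂ _+_ (∣⊤∣≡n a) (∣⁅x⁆∣≡1 q)) ⟩
    (1 + b) + (a + 1)                                   ≡⟨ rearrange a b ⟩
    suc n                                               ∎
    where
    open ≡-Reasoning
    rearrange : ∀ a b → (1 + b) + (a + 1) ≡ suc (suc a + b)
    rearrange = solve-∀

  violator : Fin (suc a) → Fin (b + 1) → HallViolator n
  violator p q = hv (X p) (Y q) (∣X∣+∣Y∣≡1+n p q)

  left : Fin (suc a) → Fin n
  left p = p ↑ˡ b

  right : Fin (b + 1) → Fin n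
  right q = castF a+[b+1]≡n (a ↑ʳ q)

  edge-violator : ∀ p′ q′ p q → edge (graphOf (violator p′ q′)) (left p) (right q) ≡ lookup ⁅ p′ ⁆ p ∧ lookup ⁅ q′ ⁆ q
  edge-violator p′ q′ p q = begin
    edge (K (X p′) (Y q′)) (left p) (right q)        ≡⟨ edge-K (X p′) (Y q′) (left p) (right q) ⟩
    lookup (X p′) (left p) ∧ lookup (Y q′) (right q) ≡⟨ cong₂ _∧_ (lookup-++ˡ ⁅ p′ ⁆ (⊤ {b}) p) lookup-Y ⟩
    lookup ⁅ p′ ⁆ p ∧ lookup ⁅ q′ ⁆ q                ∎
    where
    open ≡-Reasoning
    lookup-Y : lookup (Y q′) (right q) ≡ lookup ⁅ q′ ⁆ q
    lookup-Y = trans (lookup-cast a+[b+1]≡n (⊤ {a} ++ ⁅ q′ ⁆) (a ↑ʳ q)) (lookup-++ʳ (⊤ {a}) ⁅ q′ ⁆ q)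

  cell : Fin (suc a * (b + 1)) → Fin (suc a) × Fin (b + 1)
  cell = remQuot (b + 1)

  owns : ∀ k → T (edge (graphOf (uncurry violator (cell k))) (left (proj₁ (cell k))) (right (proj₂ (cell k))))
  owns k = subst T (sym (edge-violator p q p q)) (Equivalence.from T-∧ (T-lookup-⁅x⁆ p , T-lookup-⁅x⁆ q))
    where
    p = proj₁ (cell k)
    q = proj₂ (cell k)

  owned-only-by : ∀ {k k′} → T (edge (graphOf (uncurry violator (cell k′))) (left (proj₁ (cell k))) (right (proj₂ (cell k)))) → k′ ≡ k
  owned-only-by {k} {k′} t = begin
    k′            ≡⟨ sym (combine-remQuot (b + 1) k′) ⟩
    combine p′ q′ ≡⟨ cong₂ combine (sym p≡p′) (sym q≡q′) ⟩
    combine p q   ≡⟨ combine-remQuot (b + 1) k ⟩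
    k             ∎
    where
    open ≡-Reasoning
    p = proj₁ (cell k)
    q = proj₂ (cell k)
    p′ = proj₁ (cell k′)
    q′ = proj₂ (cell k′)
    t∧ : T (lookup ⁅ p′ ⁆ p) × T (lookup ⁅ q′ ⁆ q)
    t∧ = Equivalence.to T-∧ (subst T (edge-violator p′ q′ p q) t)
    p≡p′ : p ≡ p′
    p≡p′ = T-lookup-⁅y⁆⇒x≡y (proj₁ t∧)
    q≡q′ : q ≡ q′
    q≡q′ = T-lookup-⁅y⁆⇒x≡y (proj₂ t∧)

  hvcFamily : HVCFamily n (suc a * (b + 1))
  hvcFamily = PrivateEdges.hvcFamily (uncurry violator ∘ cell) (left ∘ proj₁ ∘ cell) (right ∘ proj₂ ∘ cell) owns owned-only-by

square≤4*bound+4 : ∀ n → n * n ≤ 4 * bound n + 4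
square≤4*bound+4 zero          = z≤n
square≤4*bound+4 (suc zero)    = s≤s z≤n
square≤4*bound+4 (suc (suc n)) = begin
  (2 + n) * (2 + n)                                   ≡⟨ expand-square n ⟩
  n * n + (4 * n + 4)                                 ≤⟨ +-mono-≤ (square≤4*bound+4 n) (m≤m+n (4 * n + 4) 4) ⟩
  4 * bound n + 4 + (4 * n + 4 + 4)                   ≡⟨ cong (λ m → 4 * bound n + 4 + (4 * m + 4 + 4)) (sym (⌊n/2⌋+⌈n/2⌉≡n n)) ⟩
  4 * bound n + 4 + (4 * (⌊ n /2⌋ + ⌈ n /2⌉) + 4 + 4) ≡⟨ bound-step ⌊ n /2⌋ ⌈ n /2⌉ ⟩
  4 * bound (2 + n) + 4                               ∎
  where
  open ≤-Reasoning
  expand-square : ∀ n → (2 + n) * (2 + n) ≡ n * n + (4 * n + 4)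
  expand-square = solve-∀
  bound-step : ∀ f c → 4 * (f * (c + 1)) + 4 + (4 * (f + c) + 4 + 4) ≡ 4 * (suc f * (suc c + 1)) + 4
  bound-step = solve-∀

proposition4p18 : (n : ℕ) → 1 < n →
    Σ (Fin (2 ^ bound n) → Graph n)
      (λ f → Injective _≡_ _≡_ f × ((i : Fin (2 ^ bound n)) → IsHVC (f i)))
    × (n * n ≤ 4 * bound n + 4)
proposition4p18 (suc zero)    (s≤s ())
proposition4p18 (suc (suc n)) _ =
  subst (λ m → HVCFamily m (bound (2 + n))) size (Staircase.hvcFamily ⌊ n /2⌋ (suc ⌈ n /2⌉)) ,
  square≤4*bound+4 (2 + n)
  where
  size : suc ⌊ n /2⌋ + suc ⌈ n /2⌉ ≡ 2 + n
  size = cong suc (trans (+-suc ⌊ n /2⌋ ⌈ n /2⌉) (cong suc (⌊n/2⌋+⌈n/2⌉≡n n)))
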